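{- (1) If $\mathcal{D}$ is a derivation in $\mathrm{NLT}_{\omega}$ whose set of open assumptions is $\Gamma$ and whose end-formula is $\beta$, then $\Gamma\Rightarrow\beta$ is derivable in $\mathrm{SLT}_{\omega}$. (2) If $\Gamma\Rightarrow\beta$ is derivable in $\mathrm{SLT}_{\omega}$ without (cut), then there is a derivation $\mathcal{D}'$ in $\mathrm{NLT}_{\omega}$ such that (a) the set of open assumptions of $\mathcal{D}'$ is $\Gamma$, (b) the end-formula of $\mathcal{D}'$ is $\beta$, and (c) $\mathcal{D}'$ is normal.
   Context: Formulas are built from countably many propositional variables using binary $\to,\wedge,\vee$ and unary $\neg,\mathrm{G},\mathrm{F},\mathrm{X}$; $\mathrm{X}^0\alpha:=\alpha$, $\mathrm{X}^{n+1}\alpha:=\mathrm{X}^n\mathrm{X}\alpha$. In all rules $i,j,k$ are arbitrary natural numbers. Convention: a sequent with empty succedent $\Gamma\Rightarrow$ is identified with the case where the end-formula on the natural deduction side is $\neg p\wedge p$ for a fixed propositional variable $p$ (so in (2), if the succedent is empty, $\beta$ is read as $\neg p\wedge p$; in (1), $\beta$ is a formula). $\mathrm{SLT}_{\omega}$: sequents $\Gamma\Rightarrow\gamma$, $\Gamma$ a finite set of formulas, $\gamma$ a formula or empty; derivations are well-founded, possibly infinitely branching trees. Initial sequents $\mathrm{X}^iq,\Gamma\Rightarrow\mathrm{X}^iq$ ($q$ a propositional variable). Rules: (cut) from $\Gamma\Rightarrow\alpha$ and $\alpha,\Sigma\Rightarrow\gamma$ infer $\Gamma,\Sigma\Rightarrow\gamma$;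 (we-right) from $\Gamma\Rightarrow$ infer $\Gamma\Rightarrow\alpha$; ($\to$left) from $\Gamma\Rightarrow\mathrm{X}^i\alpha$ and $\mathrm{X}^i\beta,\Gamma\Rightarrow\gamma$ infer $\mathrm{X}^i(\alpha\to\beta),\Gamma\Rightarrow\gamma$; ($\to$right) from $\mathrm{X}^i\alpha,\Gamma\Rightarrow\mathrm{X}^i\beta$ infer $\Gamma\Rightarrow\mathrm{X}^i(\alpha\to\beta)$; ($\neg$left) from $\Gamma\Rightarrow\mathrm{X}^i\alpha$ infer $\mathrm{X}^i\neg\alpha,\Gamma\Rightarrow$; ($\neg$right) from $\mathrm{X}^i\alpha,\Gamma\Rightarrow$ infer $\Gamma\Rightarrow\mathrm{X}^i\neg\alpha$; (ex-middle) from $\mathrm{X}^i\neg\alpha,\Gamma\Rightarrow\gamma$ and $\mathrm{X}^i\alpha,\Gamma\Rightarrow\gamma$ infer $\Gamma\Rightarrow\gamma$; ($\wedge$left) from $\mathrm{X}^i\alpha,\mathrm{X}^i\beta,\Gamma\Rightarrow\gamma$ infer $\mathrm{X}^i(\alpha\wedge\beta),\Gamma\Rightarrow\gamma$; ($\wedge$right) from $\Gamma\Rightarrow\mathrm{X}^i\alpha$ and $\Gamma\Rightarrow\mathrm{X}^i\beta$ infer $\Gamma\Rightarrow\mathrm{X}^i(\alpha\wedge\beta)$; ($\vee$left) from $\mathrm{X}^i\alpha,\Gamma\Rightarrow\gamma$ and $\mathrm{X}^i\beta,\Gamma\Rightarrow\gamma$ infer $\mathrm{X}^i(\alpha\vee\beta),\Gamma\Rightarrow\gamma$;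 ($\vee$right1/2) from $\Gamma\Rightarrow\mathrm{X}^i\alpha$ (resp. $\Gamma\Rightarrow\mathrm{X}^i\beta$) infer $\Gamma\Rightarrow\mathrm{X}^i(\alpha\vee\beta)$; (Gleft) from $\mathrm{X}^{i+k}\alpha,\Gamma\Rightarrow\gamma$ infer $\mathrm{X}^i\mathrm{G}\alpha,\Gamma\Rightarrow\gamma$; (Gright) from all $\Gamma\Rightarrow\mathrm{X}^{i+j}\alpha$ ($j\in\omega$) infer $\Gamma\Rightarrow\mathrm{X}^i\mathrm{G}\alpha$; (Fleft) from all $\mathrm{X}^{i+j}\alpha,\Gamma\Rightarrow\gamma$ ($j\in\omega$) infer $\mathrm{X}^i\mathrm{F}\alpha,\Gamma\Rightarrow\gamma$; (Fright) from $\Gamma\Rightarrow\mathrm{X}^{i+k}\alpha$ infer $\Gamma\Rightarrow\mathrm{X}^i\mathrm{F}\alpha$. $\mathrm{NLT}_{\omega}$ is a natural deduction system (derivations are well-founded, possibly infinitely branching trees of formulas, with assumptions that may be discharged, $[\cdot]$ marking discharged assumptions) with rules: ($\to$I) from a derivation of $\mathrm{X}^i\beta$ infer $\mathrm{X}^i(\alpha\to\beta)$ discharging $\mathrm{X}^i\alpha$ (discharge may be vacuous); ($\to$E) from $\mathrm{X}^i(\alpha\to\beta)$ and $\mathrm{X}^i\alpha$ infer $\mathrm{X}^i\beta$; (EXP) from $\mathrm{X}^i\neg\alpha$ and $\mathrm{X}^i\alpha$ infer any $\gamma$; (EXM) from a derivation of $\gamma$ from $[\mathrm{X}^i\neg\alpha]$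 and a derivation of $\gamma$ from $[\mathrm{X}^i\alpha]$ infer $\gamma$; ($\neg$I) from a derivation of $\mathrm{X}^j\neg\gamma$ from $[\mathrm{X}^i\alpha]$ and a derivation of $\mathrm{X}^j\gamma$ from $[\mathrm{X}^i\alpha]$ infer $\mathrm{X}^i\neg\alpha$; ($\wedge$I) from $\mathrm{X}^i\alpha$ and $\mathrm{X}^i\beta$ infer $\mathrm{X}^i(\alpha\wedge\beta)$; ($\wedge$E1/2) from $\mathrm{X}^i(\alpha\wedge\beta)$ infer $\mathrm{X}^i\alpha$ (resp. $\mathrm{X}^i\beta$); ($\vee$I1/2) from $\mathrm{X}^i\alpha$ (resp. $\mathrm{X}^i\beta$) infer $\mathrm{X}^i(\alpha\vee\beta)$; ($\vee$E) from $\mathrm{X}^i(\alpha\vee\beta)$, a derivation of $\gamma$ from $[\mathrm{X}^i\alpha]$ and a derivation of $\gamma$ from $[\mathrm{X}^i\beta]$ infer $\gamma$; (GI) from all $\mathrm{X}^{i+j}\alpha$ ($j\in\omega$) infer $\mathrm{X}^i\mathrm{G}\alpha$; (GE) from $\mathrm{X}^i\mathrm{G}\alpha$ infer $\mathrm{X}^{i+k}\alpha$; (FI) from $\mathrm{X}^{i+k}\alpha$ infer $\mathrm{X}^i\mathrm{F}\alpha$; (FE) from $\mathrm{X}^i\mathrm{F}\alpha$ and, for every $j\in\omega$, a derivation of $\gamma$ from $[\mathrm{X}^{i+j}\alpha]$, infer $\gamma$. Introduction rules: ($\to$I), ($\wedge$I), ($\vee$I1), ($\vee$I2), ($\neg$I),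 (GI), (FI), (EXM). Elimination rules: ($\to$E), ($\wedge$E1), ($\wedge$E2), ($\vee$E), (GE), (FE), (EXP). Major premises: $\mathrm{X}^i(\alpha\to\beta)$ in ($\to$E), $\mathrm{X}^i(\alpha\wedge\beta)$ in ($\wedge$E1/2), $\mathrm{X}^i(\alpha\vee\beta)$ in ($\vee$E), $\mathrm{X}^i\mathrm{G}\alpha$ in (GE), $\mathrm{X}^i\mathrm{F}\alpha$ in (FE), $\mathrm{X}^i\neg\alpha$ in (EXP). A maximum formula is a formula occurrence that is the conclusion of an introduction rule, of ($\vee$E), or of (EXP), and is also the major premise of an elimination rule. A derivation is normal if it has no maximum formula. -}

module Defs where

open import Data.Nat using (ℕ; zero; suc; _+_)
open import Data.List using (List; []; _∷_; _++_)
open import Data.List.Membership.Propositional using (_∈_)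
open import Data.Maybe using (Maybe; just; nothing)
open import Data.Bool using (Bool; true; false)
open import Data.Product using (Σ; _×_)
open import Data.Sum using (_⊎_)
open import Data.Unit using (⊤)
open import Data.Empty using (⊥)
open import Relation.Nullary using (¬_)
open import Relation.Binary.PropositionalEquality using (_≡_)

data Fm : Set where
  atom : ℕ → Fm
  imp and or : Fm → Fm → Fm
  neg G F X : Fm → Fm

Xⁿ : ℕ → Fm → Fm
Xⁿ zero    a = a
Xⁿ (suc n) a = Xⁿ n (X a)

-- Finite sets of formulas are represented by lists up to having the
-- same elements.

_≋_ : List Fm → List Fm → Set
Γ ≋ Δ = ∀ x → (x ∈ Γ → x ∈ Δ) × (x ∈ Δ → x ∈ Γ)

-- SLT c Γ γ : a derivation of Γ ⇒ γ (γ = nothing: empty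
-- succedent).  The index c says whether (cut) may be used:
-- SLT true = SLT_ω, SLT false = SLT_ω without (cut).
-- The rule `set` only re-presents the finite set Γ by another list with
-- the same elements (contexts are sets, "α , Γ" is {α} ∪ Γ).

data SLT : Bool → List Fm → Maybe Fm → Set where
  set     : ∀ {c Γ Δ γ} → Γ ≋ Δ → SLT c Γ γ → SLT c Δ γ
  init    : ∀ {c} i q Γ → SLT c (Xⁿ i (atom q) ∷ Γ) (just (Xⁿ i (atom q)))
  cut     : ∀ {Γ Σ γ} α → SLT true Γ (just α) → SLT true (α ∷ Σ) γ
            → SLT true (Γ ++ Σ) γ
  we-right : ∀ {c Γ} α → SLT c Γ nothing → SLT c Γ (just α)
  impL    : ∀ {c Γ γ} i α β → SLT c Γ (just (Xⁿ i α))
            → SLT c (Xⁿ i β ∷ Γ) γ → SLT c (Xⁿ i (imp α β) ∷ Γ) γ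
  impR    : ∀ {c Γ} i α β → SLT c (Xⁿ i α ∷ Γ) (just (Xⁿ i β))
            → SLT c Γ (just (Xⁿ i (imp α β)))
  negL    : ∀ {c Γ} i α → SLT c Γ (just (Xⁿ i α))
            → SLT c (Xⁿ i (neg α) ∷ Γ) nothing
  negR    : ∀ {c Γ} i α → SLT c (Xⁿ i α ∷ Γ) nothing
            → SLT c Γ (just (Xⁿ i (neg α)))
  ex-middle : ∀ {c Γ γ} i α → SLT c (Xⁿ i (neg α) ∷ Γ) γ
            → SLT c (Xⁿ i α ∷ Γ) γ → SLT c Γ γ
  andL    : ∀ {c Γ γ} i α β → SLT c (Xⁿ i α ∷ Xⁿ i β ∷ Γ) γ
            → SLT c (Xⁿ i (and α β) ∷ Γ) γ
  andR    : ∀ {c Γ} i α β → SLT c Γ (just (Xⁿ i α)) → SLT c Γ (just (Xⁿ i β))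
            → SLT c Γ (just (Xⁿ i (and α β)))
  orL     : ∀ {c Γ γ} i α β → SLT c (Xⁿ i α ∷ Γ) γ → SLT c (Xⁿ i β ∷ Γ) γ
            → SLT c (Xⁿ i (or α β) ∷ Γ) γ
  orR1    : ∀ {c Γ} i α β → SLT c Γ (just (Xⁿ i α))
            → SLT c Γ (just (Xⁿ i (or α β)))
  orR2    : ∀ {c Γ} i α β → SLT c Γ (just (Xⁿ i β))
            → SLT c Γ (just (Xⁿ i (or α β)))
  GL      : ∀ {c Γ γ} i k α → SLT c (Xⁿ (i + k) α ∷ Γ) γ
            → SLT c (Xⁿ i (G α) ∷ Γ) γ
  GR      : ∀ {c Γ} i α → ((j : ℕ) → SLT c Γ (just (Xⁿ (i + j) α)))
            → SLT c Γ (just (Xⁿ i (G α)))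
  FL      : ∀ {c Γ γ} i α → ((j : ℕ) → SLT c (Xⁿ (i + j) α ∷ Γ) γ)
            → SLT c (Xⁿ i (F α) ∷ Γ) γ
  FR      : ∀ {c Γ} i k α → SLT c Γ (just (Xⁿ (i + k) α))
            → SLT c Γ (just (Xⁿ i (F α)))

-- Assumption leaves
-- are either `hyp a` (an open assumption occurrence of a) or `dis p`
-- (an occurrence discharged by the rule that pushed position p of Δ).
-- Discharge is selective: an occurrence of the discharged formula may
-- be left open by using `hyp`; discharge may be vacuous.

data ND (Δ : List Fm) : Fm → Set where
  hyp  : ∀ a → ND Δ a
  dis  : ∀ {a} → a ∈ Δ → ND Δ a
  impI : ∀ i α β → ND (Xⁿ i α ∷ Δ) (Xⁿ i β) → ND Δ (Xⁿ i (imp α β))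
  impE : ∀ i α β → ND Δ (Xⁿ i (imp α β)) → ND Δ (Xⁿ i α) → ND Δ (Xⁿ i β)
  EXP  : ∀ i α γ → ND Δ (Xⁿ i (neg α)) → ND Δ (Xⁿ i α) → ND Δ γ
  EXM  : ∀ i α γ → ND (Xⁿ i (neg α) ∷ Δ) γ → ND (Xⁿ i α ∷ Δ) γ → ND Δ γ
  negI : ∀ i j α γ → ND (Xⁿ i α ∷ Δ) (Xⁿ j (neg γ)) → ND (Xⁿ i α ∷ Δ) (Xⁿ j γ)
         → ND Δ (Xⁿ i (neg α))
  andI : ∀ i α β → ND Δ (Xⁿ i α) → ND Δ (Xⁿ i β) → ND Δ (Xⁿ i (and α β))
  andE1 : ∀ i α β → ND Δ (Xⁿ i (and α β)) → ND Δ (Xⁿ i α)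
  andE2 : ∀ i α β → ND Δ (Xⁿ i (and α β)) → ND Δ (Xⁿ i β)
  orI1 : ∀ i α β → ND Δ (Xⁿ i α) → ND Δ (Xⁿ i (or α β))
  orI2 : ∀ i α β → ND Δ (Xⁿ i β) → ND Δ (Xⁿ i (or α β))
  orE  : ∀ i α β γ → ND Δ (Xⁿ i (or α β)) → ND (Xⁿ i α ∷ Δ) γ
         → ND (Xⁿ i β ∷ Δ) γ → ND Δ γ
  GI   : ∀ i α → ((j : ℕ) → ND Δ (Xⁿ (i + j) α)) → ND Δ (Xⁿ i (G α))
  GE   : ∀ i k α → ND Δ (Xⁿ i (G α)) → ND Δ (Xⁿ (i + k) α)
  FI   : ∀ i k α → ND Δ (Xⁿ (i + k) α) → ND Δ (Xⁿ i (F α))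
  FE   : ∀ i α γ → ND Δ (Xⁿ i (F α)) → ((j : ℕ) → ND (Xⁿ (i + j) α ∷ Δ) γ)
         → ND Δ γ

Open : ∀ {Δ φ} → ND Δ φ → Fm → Set
Open (hyp a) x = a ≡ x
Open (dis _) x = ⊥
Open (impI _ _ _ d) x = Open d x
Open (impE _ _ _ d e) x = Open d x ⊎ Open e x
Open (EXP _ _ _ d e) x = Open d x ⊎ Open e x
Open (EXM _ _ _ d e) x = Open d x ⊎ Open e x
Open (negI _ _ _ _ d e) x = Open d x ⊎ Open e x
Open (andI _ _ _ d e) x = Open d x ⊎ Open e x
Open (andE1 _ _ _ d) x = Open d x
Open (andE2 _ _ _ d) x = Open d x
Open (orI1 _ _ _ d) x = Open d x
Open (orI2 _ _ _ d) x = Open d x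
Open (orE _ _ _ _ d e f) x = Open d x ⊎ (Open e x ⊎ Open f x)
Open (GI _ _ ds) x = Σ ℕ (λ j → Open (ds j) x)
Open (GE _ _ _ d) x = Open d x
Open (FI _ _ _ d) x = Open d x
Open (FE _ _ _ d es) x = Open d x ⊎ Σ ℕ (λ j → Open (es j) x)

OpenIs : ∀ {Δ φ} → ND Δ φ → List Fm → Set
OpenIs d Γ = ∀ x → (Open d x → x ∈ Γ) × (x ∈ Γ → Open d x)

MaxConcl : ∀ {Δ φ} → ND Δ φ → Set
MaxConcl (hyp _) = ⊥
MaxConcl (dis _) = ⊥
MaxConcl (impI _ _ _ _) = ⊤
MaxConcl (impE _ _ _ _ _) = ⊥
MaxConcl (EXP _ _ _ _ _) = ⊤
MaxConcl (EXM _ _ _ _ _) = ⊤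
MaxConcl (negI _ _ _ _ _ _) = ⊤
MaxConcl (andI _ _ _ _ _) = ⊤
MaxConcl (andE1 _ _ _ _) = ⊥
MaxConcl (andE2 _ _ _ _) = ⊥
MaxConcl (orI1 _ _ _ _) = ⊤
MaxConcl (orI2 _ _ _ _) = ⊤
MaxConcl (orE _ _ _ _ _ _ _) = ⊤
MaxConcl (GI _ _ _) = ⊤
MaxConcl (GE _ _ _ _) = ⊥
MaxConcl (FI _ _ _ _) = ⊤
MaxConcl (FE _ _ _ _ _) = ⊥

Normal : ∀ {Δ φ} → ND Δ φ → Set
Normal (hyp _) = ⊤
Normal (dis _) = ⊤
Normal (impI _ _ _ d) = Normal d
Normal (impE _ _ _ d e) = ¬ MaxConcl d × Normal d × Normal e
Normal (EXP _ _ _ d e) = ¬ MaxConcl d × Normal d × Normal e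
Normal (EXM _ _ _ d e) = Normal d × Normal e
Normal (negI _ _ _ _ d e) = Normal d × Normal e
Normal (andI _ _ _ d e) = Normal d × Normal e
Normal (andE1 _ _ _ d) = ¬ MaxConcl d × Normal d
Normal (andE2 _ _ _ d) = ¬ MaxConcl d × Normal d
Normal (orI1 _ _ _ d) = Normal d
Normal (orI2 _ _ _ d) = Normal d
Normal (orE _ _ _ _ d e f) = ¬ MaxConcl d × Normal d × Normal e × Normal f
Normal (GI _ _ ds) = (j : ℕ) → Normal (ds j)
Normal (GE _ _ _ d) = ¬ MaxConcl d × Normal d
Normal (FI _ _ _ d) = Normal d
Normal (FE _ _ _ d es) = ¬ MaxConcl d × Normal d × ((j : ℕ) → Normal (es j))

endF : ℕ → Maybe Fm → Fm
endF p (just β) = β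
endF p nothing  = and (neg (atom p)) (atom p)

-- (1) Introductions are right rules, and an elimination is a (cut) of its
-- major premise against the corresponding left rule applied to an identity
-- sequent; identity sequents for compound formulas follow from the initial
-- ones by induction on the formula.
--
-- (2) Right rules become introductions and left rules become eliminations
-- whose major premise is an assumption, so no maximum formula arises; the
-- conclusion of such an elimination is joined to the translated premise by
-- (EXM) and (EXP) rather than by substitution. Antecedent formulas are either
-- discharged by the rule that introduced them or left open, and formulas of Γ
-- that the derivation never uses are made open by the same detour.

module Submission where

open import Defs
open import Data.Nat using (ℕ; suc; _+_)
open import Data.List using (List; []; _∷_; _++_)
open import Data.List.Membership.Propositional using (_∈_)
open import Data.List.Membership.Propositional.Properties using (∈-++⁻)
open import Data.List.Relation.Binary.Subset.Propositional using (_⊆_)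
open import Data.List.Relation.Binary.Subset.Propositional.Properties
  using (⊆-refl; xs⊆x∷xs; ∷⁺ʳ; ∈-∷⁺ʳ; xs⊆xs++ys; xs⊆ys++xs)
open import Data.List.Relation.Unary.Any using (here; there)
open import Data.Maybe using (Maybe; just; nothing)
open import Data.Maybe.Relation.Unary.All using (All; just; nothing)
open import Data.Bool using (Bool; true; false)
open import Data.Product using (Σ; _×_; _,_; proj₁)
open import Data.Sum using (inj₁; inj₂; [_,_]; reduce)
open import Data.Unit using (tt)
open import Function using (_∘_)
open import Relation.Nullary using (¬_)
open import Relation.Binary.PropositionalEquality using (_≡_; refl)

variable
  c : Bool
  φ χ x y : Fm
  γ : Maybe Fm
  Γ Δ Θ : List Fm

reorder : Γ ⊆ Θ → Θ ⊆ Γ → SLT c Γ γ → SLT c Θ γ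
reorder to from = set (λ _ → to , from)

absorb : x ∈ Θ → SLT c (x ∷ Θ) γ → SLT c Θ γ
absorb m = reorder (∈-∷⁺ʳ m ⊆-refl) (xs⊆x∷xs _ _)

cut-shared : ∀ α → SLT true Θ (just α) → SLT true (α ∷ Θ) γ → SLT true Θ γ
cut-shared {Θ} α d e = reorder (reduce ∘ ∈-++⁻ Θ) (xs⊆xs++ys Θ Θ) (cut α d e)

identity : ∀ α i → Xⁿ i α ∈ Θ → SLT c Θ (just (Xⁿ i α))
identity (atom q) i m = absorb m (init i q _)
identity (imp α β) i m =
  impR i α β (absorb (there m)
    (impL i α β (identity α i (here refl)) (identity β i (here refl))))
identity (and α β) i m =
  andR i α β (absorb m (andL i α β (identity α i (here refl))))
             (absorb m (andL i α β (identity β i (there (here refl)))))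
identity (or α β) i m =
  absorb m (orL i α β (orR1 i α β (identity α i (here refl)))
                      (orR2 i α β (identity β i (here refl))))
identity (neg α) i m = negR i α (absorb (there m) (negL i α (identity α i (here refl))))
identity (G α) i m = GR i α (λ j → absorb m (GL i j α (identity α (i + j) (here refl))))
identity (F α) i m = absorb m (FL i α (λ j → FR i j α (identity α (i + j) (here refl))))
identity (X α) i m = identity α (suc i) m

ND⇒SLT : (d : ND Δ φ) → Δ ⊆ Θ → (∀ {x} → Open d x → x ∈ Θ)
       → SLT true Θ (just φ)
ND⇒SLT (hyp a) s o = identity a 0 (o refl)
ND⇒SLT (dis p) s o = identity _ 0 (s p)
ND⇒SLT (impI i α β d) s o = impR i α β (ND⇒SLT d (∷⁺ʳ _ s) (there ∘ o))
ND⇒SLT (impE i α β d e) s o =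
  cut-shared _ (ND⇒SLT d s (o ∘ inj₁))
    (impL i α β (ND⇒SLT e s (o ∘ inj₂)) (identity β i (here refl)))
ND⇒SLT (EXP i α γ d e) s o =
  cut-shared _ (ND⇒SLT d s (o ∘ inj₁))
    (we-right γ (negL i α (ND⇒SLT e s (o ∘ inj₂))))
ND⇒SLT (EXM i α γ d e) s o =
  ex-middle i α (ND⇒SLT d (∷⁺ʳ _ s) (there ∘ o ∘ inj₁))
                (ND⇒SLT e (∷⁺ʳ _ s) (there ∘ o ∘ inj₂))
ND⇒SLT (negI i j α γ d e) s o =
  negR i α (cut-shared _ (ND⇒SLT d (∷⁺ʳ _ s) (there ∘ o ∘ inj₁))
                         (negL j γ (ND⇒SLT e (∷⁺ʳ _ s) (there ∘ o ∘ inj₂))))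
ND⇒SLT (andI i α β d e) s o =
  andR i α β (ND⇒SLT d s (o ∘ inj₁)) (ND⇒SLT e s (o ∘ inj₂))
ND⇒SLT (andE1 i α β d) s o =
  cut-shared _ (ND⇒SLT d s o) (andL i α β (identity α i (here refl)))
ND⇒SLT (andE2 i α β d) s o =
  cut-shared _ (ND⇒SLT d s o) (andL i α β (identity β i (there (here refl))))
ND⇒SLT (orI1 i α β d) s o = orR1 i α β (ND⇒SLT d s o)
ND⇒SLT (orI2 i α β d) s o = orR2 i α β (ND⇒SLT d s o)
ND⇒SLT (orE i α β γ d e f) s o =
  cut-shared _ (ND⇒SLT d s (o ∘ inj₁))
    (orL i α β (ND⇒SLT e (∷⁺ʳ _ s) (there ∘ o ∘ inj₂ ∘ inj₁))
               (ND⇒SLT f (∷⁺ʳ _ s) (there ∘ o ∘ inj₂ ∘ inj₂)))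
ND⇒SLT (GI i α ds) s o = GR i α (λ j → ND⇒SLT (ds j) s (o ∘ (j ,_)))
ND⇒SLT (GE i k α d) s o =
  cut-shared _ (ND⇒SLT d s o) (GL i k α (identity α (i + k) (here refl)))
ND⇒SLT (FI i k α d) s o = FR i k α (ND⇒SLT d s o)
ND⇒SLT (FE i α γ d es) s o =
  cut-shared _ (ND⇒SLT d s (o ∘ inj₁))
    (FL i α (λ j → ND⇒SLT (es j) (∷⁺ʳ _ s) (there ∘ o ∘ inj₂ ∘ (j ,_))))

record NormalND (Θ Δ : List Fm) (χ : Fm) : Set where
  constructor normalND
  field
    derivation : ND Δ χ
    opens⊆ : ∀ {x} → Open derivation x → x ∈ Θ
    normal : Normal derivation

open NormalND

assume : ∀ Δ → x ∈ Δ ++ Θ → ND Δ x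
assume Δ m with ∈-++⁻ Δ m
... | inj₁ p = dis p
... | inj₂ _ = hyp _

assume-opens⊆ : ∀ Δ (m : x ∈ Δ ++ Θ) → Open (assume Δ m) y → y ∈ Θ
assume-opens⊆ Δ m with ∈-++⁻ Δ m
... | inj₁ _ = λ ()
... | inj₂ q = λ { refl → q }

assume-¬max : ∀ Δ (m : x ∈ Δ ++ Θ) → ¬ MaxConcl (assume Δ m)
assume-¬max Δ m with ∈-++⁻ Δ m
... | inj₁ _ = λ ()
... | inj₂ _ = λ ()

assume-normal : ∀ Δ (m : x ∈ Δ ++ Θ) → Normal (assume Δ m)
assume-normal Δ m with ∈-++⁻ Δ m
... | inj₁ _ = tt
... | inj₂ _ = tt

assumption : x ∈ Δ ++ Θ → NormalND Θ Δ x
assumption {Δ = Δ} m = normalND (assume Δ m) (assume-opens⊆ Δ m) (assume-normal Δ m)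

impIₙ : ∀ i α β → NormalND Θ (Xⁿ i α ∷ Δ) (Xⁿ i β)
      → NormalND Θ Δ (Xⁿ i (imp α β))
impIₙ i α β (normalND d o n) = normalND (impI i α β d) o n

impEₙ : ∀ i α β → Xⁿ i (imp α β) ∈ Δ ++ Θ
      → NormalND Θ Δ (Xⁿ i α) → NormalND Θ Δ (Xⁿ i β)
impEₙ {Δ = Δ} i α β m (normalND d o n) =
  normalND (impE i α β (assume Δ m) d) [ assume-opens⊆ Δ m , o ]
           (assume-¬max Δ m , assume-normal Δ m , n)

EXPₙ : ∀ i α → Xⁿ i (neg α) ∈ Δ ++ Θ → NormalND Θ Δ (Xⁿ i α)
     → NormalND Θ Δ χ
EXPₙ {Δ = Δ} {χ = χ} i α m (normalND d o n) =
  normalND (EXP i α χ (assume Δ m) d) [ assume-opens⊆ Δ m , o ]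
           (assume-¬max Δ m , assume-normal Δ m , n)

EXMₙ : ∀ i α → NormalND Θ (Xⁿ i (neg α) ∷ Δ) χ → NormalND Θ (Xⁿ i α ∷ Δ) χ
     → NormalND Θ Δ χ
EXMₙ {χ = χ} i α (normalND d o n) (normalND e o′ n′) =
  normalND (EXM i α χ d e) [ o , o′ ] (n , n′)

negIₙ : ∀ i j α γ → NormalND Θ (Xⁿ i α ∷ Δ) (Xⁿ j (neg γ))
      → NormalND Θ (Xⁿ i α ∷ Δ) (Xⁿ j γ) → NormalND Θ Δ (Xⁿ i (neg α))
negIₙ i j α γ (normalND d o n) (normalND e o′ n′) =
  normalND (negI i j α γ d e) [ o , o′ ] (n , n′)

andIₙ : ∀ i α β → NormalND Θ Δ (Xⁿ i α) → NormalND Θ Δ (Xⁿ i β)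
      → NormalND Θ Δ (Xⁿ i (and α β))
andIₙ i α β (normalND d o n) (normalND e o′ n′) =
  normalND (andI i α β d e) [ o , o′ ] (n , n′)

andE1ₙ : ∀ i α β → Xⁿ i (and α β) ∈ Δ ++ Θ → NormalND Θ Δ (Xⁿ i α)
andE1ₙ {Δ = Δ} i α β m =
  normalND (andE1 i α β (assume Δ m)) (assume-opens⊆ Δ m)
           (assume-¬max Δ m , assume-normal Δ m)

andE2ₙ : ∀ i α β → Xⁿ i (and α β) ∈ Δ ++ Θ → NormalND Θ Δ (Xⁿ i β)
andE2ₙ {Δ = Δ} i α β m =
  normalND (andE2 i α β (assume Δ m)) (assume-opens⊆ Δ m)
           (assume-¬max Δ m , assume-normal Δ m)

orI1ₙ : ∀ i α β → NormalND Θ Δ (Xⁿ i α) → NormalND Θ Δ (Xⁿ i (or α β))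
orI1ₙ i α β (normalND d o n) = normalND (orI1 i α β d) o n

orI2ₙ : ∀ i α β → NormalND Θ Δ (Xⁿ i β) → NormalND Θ Δ (Xⁿ i (or α β))
orI2ₙ i α β (normalND d o n) = normalND (orI2 i α β d) o n

orEₙ : ∀ i α β → Xⁿ i (or α β) ∈ Δ ++ Θ
     → NormalND Θ (Xⁿ i α ∷ Δ) χ → NormalND Θ (Xⁿ i β ∷ Δ) χ
     → NormalND Θ Δ χ
orEₙ {Δ = Δ} {χ = χ} i α β m (normalND d o n) (normalND e o′ n′) =
  normalND (orE i α β χ (assume Δ m) d e) [ assume-opens⊆ Δ m , [ o , o′ ] ]
           (assume-¬max Δ m , assume-normal Δ m , n , n′)

GIₙ : ∀ i α → ((j : ℕ) → NormalND Θ Δ (Xⁿ (i + j) α))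
    → NormalND Θ Δ (Xⁿ i (G α))
GIₙ i α ds =
  normalND (GI i α (derivation ∘ ds)) (λ (j , o) → opens⊆ (ds j) o) (normal ∘ ds)

GEₙ : ∀ i k α → Xⁿ i (G α) ∈ Δ ++ Θ → NormalND Θ Δ (Xⁿ (i + k) α)
GEₙ {Δ = Δ} i k α m =
  normalND (GE i k α (assume Δ m)) (assume-opens⊆ Δ m) (assume-¬max Δ m , assume-normal Δ m)

FIₙ : ∀ i k α → NormalND Θ Δ (Xⁿ (i + k) α) → NormalND Θ Δ (Xⁿ i (F α))
FIₙ i k α (normalND d o n) = normalND (FI i k α d) o n

FEₙ : ∀ i α → Xⁿ i (F α) ∈ Δ ++ Θ
    → ((j : ℕ) → NormalND Θ (Xⁿ (i + j) α ∷ Δ) χ) → NormalND Θ Δ χ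
FEₙ {Δ = Δ} {χ = χ} i α m es =
  normalND (FE i α χ (assume Δ m) (derivation ∘ es))
           [ assume-opens⊆ Δ m , (λ (j , o) → opens⊆ (es j) o) ]
           (assume-¬max Δ m , assume-normal Δ m , normal ∘ es)

-- Split on Xⁱα and close the ¬Xⁱα branch by (EXP), whose major premise is an
-- assumption, so no maximum formula is created.
plug : ∀ i α → NormalND Θ (Xⁿ i (neg α) ∷ Δ) (Xⁿ i α)
     → NormalND Θ (Xⁿ i α ∷ Δ) χ → NormalND Θ Δ χ
plug i α d = EXMₙ i α (EXPₙ i α (here refl) d)

-- Γ ⊆ Δ ++ Θ: each antecedent formula is discharged (in Δ) or stays open (in
-- Θ); an empty succedent (γ = nothing) may be realised by any end-formula χ.
SLT⇒ND : SLT false Γ γ → Γ ⊆ Δ ++ Θ → All (_≡ χ) γ → NormalND Θ Δ χ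
SLT⇒ND (set eq d) s t = SLT⇒ND d (s ∘ proj₁ (eq _)) t
SLT⇒ND (init i q _) s (just refl) = assumption (s (here refl))
SLT⇒ND (we-right α d) s (just refl) = SLT⇒ND d s nothing
SLT⇒ND (impL i α β d e) s t =
  plug i β (impEₙ i α β (there (s (here refl)))
                        (SLT⇒ND d (there ∘ s ∘ there) (just refl)))
           (SLT⇒ND e (∷⁺ʳ _ (s ∘ there)) t)
SLT⇒ND (impR i α β d) s (just refl) = impIₙ i α β (SLT⇒ND d (∷⁺ʳ _ s) (just refl))
SLT⇒ND (negL i α d) s nothing =
  EXPₙ i α (s (here refl)) (SLT⇒ND d (s ∘ there) (just refl))
SLT⇒ND (negR i α d) s (just refl) =
  negIₙ i 0 α (atom 0) (SLT⇒ND d (∷⁺ʳ _ s) nothing) (SLT⇒ND d (∷⁺ʳ _ s) nothing)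
SLT⇒ND (ex-middle i α d e) s t =
  EXMₙ i α (SLT⇒ND d (∷⁺ʳ _ s) t) (SLT⇒ND e (∷⁺ʳ _ s) t)
SLT⇒ND (andL i α β d) s t =
  plug i β (andE2ₙ i α β (there (s (here refl))))
    (plug i α (andE1ₙ i α β (there (there (s (here refl)))))
      (SLT⇒ND d (∷⁺ʳ _ (∷⁺ʳ _ (s ∘ there))) t))
SLT⇒ND (andR i α β d e) s (just refl) =
  andIₙ i α β (SLT⇒ND d s (just refl)) (SLT⇒ND e s (just refl))
SLT⇒ND (orL i α β d e) s t =
  orEₙ i α β (s (here refl)) (SLT⇒ND d (∷⁺ʳ _ (s ∘ there)) t)
                             (SLT⇒ND e (∷⁺ʳ _ (s ∘ there)) t)
SLT⇒ND (orR1 i α β d) s (just refl) = orI1ₙ i α β (SLT⇒ND d s (just refl))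
SLT⇒ND (orR2 i α β d) s (just refl) = orI2ₙ i α β (SLT⇒ND d s (just refl))
SLT⇒ND (GL i k α d) s t =
  plug (i + k) α (GEₙ i k α (there (s (here refl)))) (SLT⇒ND d (∷⁺ʳ _ (s ∘ there)) t)
SLT⇒ND (GR i α ds) s (just refl) = GIₙ i α (λ j → SLT⇒ND (ds j) s (just refl))
SLT⇒ND (FL i α ds) s t =
  FEₙ i α (s (here refl)) (λ j → SLT⇒ND (ds j) (∷⁺ʳ _ (s ∘ there)) t)
SLT⇒ND (FR i k α d) s (just refl) = FIₙ i k α (SLT⇒ND d s (just refl))

exposing : ∀ as → as ⊆ Θ → (∀ Δ → NormalND Θ Δ χ)
         → Σ (NormalND Θ Δ χ) (λ r → ∀ {x} → x ∈ as → Open (derivation r) x)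
exposing [] _ r = r _ , λ ()
exposing (a ∷ as) sub r with exposing as (sub ∘ there) r
... | e , exposed =
  plug 0 a (normalND (hyp a) (λ { refl → sub (here refl) }) tt) e ,
  λ { (here refl) → inj₁ (inj₂ refl) ; (there m) → inj₂ (exposed m) }

SLT⇒normal : SLT false Γ γ → All (_≡ χ) γ
           → Σ (ND [] χ) (λ d → OpenIs d Γ × Normal d)
SLT⇒normal {Γ} s t with exposing Γ ⊆-refl (λ Δ → SLT⇒ND s (xs⊆ys++xs Γ Δ) t)
... | normalND d o n , exposed = d , (λ _ → o , exposed) , n

endF-fits : ∀ p γ → All (_≡ endF p γ) γ
endF-fits p (just β) = just refl
endF-fits p nothing = nothing

lemma3 : ((Γ : List Fm) (β : Fm) (d : ND [] β) → OpenIs d Γ → SLT true Γ (just β))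
         × ((p : ℕ) (Γ : List Fm) (γ : Maybe Fm) → SLT false Γ γ
            → Σ (ND [] (endF p γ)) (λ d → OpenIs d Γ × Normal d))
lemma3 = (λ Γ β d opens → ND⇒SLT d (λ ()) (proj₁ (opens _)))
       , (λ p Γ γ s → SLT⇒normal s (endF-fits p γ))
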